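{- Let $0\le q<1$, let $w=(w_{\ell,j})_{1\le\ell\le n,1\le j\le m}$ be a matrix of nonnegative integers, and let $(\lambda^j_k(\ell))$ be the GT patterns produced by $q$RSK applied to $w$ starting from the empty initial condition $\lambda(0)\equiv0$. Then almost surely $\lambda^j_k(\ell)=0$ for all $0\le\ell<k\le j\le m$.
   Context: Notation: $(k)_q=(q;q)_k$, $\binom{a}{b}_q=\frac{(a)_q}{(b)_q(a-b)_q}$, $0^0=1$. $q\mathrm{Hyp}(m_1,m_2,k)$ ($m_1,k\in\mathbb N$, $m_2\in\mathbb N\cup\{\infty\}$) has pmf $s\mapsto q^{(m_1-s)(k-s)}\binom{m_1}{s}_q\binom{m_2}{k-s}_q/\binom{m_1+m_2}{k}_q$ on $\max(0,k-m_2)\le s\le\min(m_1,k)$ (for $m_2=\infty$: $q^{(m_1-s)(k-s)}\frac{(m_1)_q(k)_q}{(s)_q(m_1-s)_q(k-s)_q}$). $q$RSK: GT patterns $(\lambda^j_k)_{1\le k\le j\le m}$ with $\lambda^{j+1}_{k+1}\le\lambda^j_k\le\lambda^{j+1}_k$; conventions $\lambda^j_0=\infty$, $\lambda^j_k=0$ for $k>j$, level-$0$ entries $0$. Inserting $(a_1,\dots,a_m)$ into $\lambda$ to get $\tilde\lambda$: $a^j_1=a_j$; for $j=1,\dots,m$, for $k=1,\dots,j$: if $k<j$, sample independently $a^j_{k+1}\sim q\mathrm{Hyp}(\tilde\lambda^{j-1}_k-\lambda^{j-1}_k,\lambda^{j-1}_{k-1}-\tilde\lambda^{j-1}_k,\lambda^j_k-\lambda^{j-1}_k)$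 and set $\tilde\lambda^j_k=a^j_k+\lambda^j_k+\tilde\lambda^{j-1}_k-\lambda^{j-1}_k-a^j_{k+1}$; if $k=j$, set $\tilde\lambda^j_j=\lambda^j_j+a^j_j$. With $\lambda(0)\equiv0$, $\lambda(\ell)$ is the insertion of $(w_{\ell,1},\dots,w_{\ell,m})$ into $\lambda(\ell-1)$ with fresh randomness.
   Formalization: The parameter q is taken rational, with $0\le q<1$. -}

module Defs where

open import Data.Nat as ℕ using (ℕ; zero; suc; _∸_; _⊔_; _⊓_)
open import Data.Rational as ℚ using (ℚ; 0ℚ; 1ℚ; _÷_; ≢-nonZero)
open import Data.Rational.Properties using (_≟_)
open import Relation.Nullary using (yes; no)
open import Data.Bool using (true; false)
open import Data.Product using (_×_)

_^ℚ_ : ℚ → ℕ → ℚ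
q ^ℚ zero  = 1ℚ
q ^ℚ suc n = q ^ℚ n ℚ.* q

-- total division (x / 0 := 0); only ever used with nonzero denominators
_⊘_ : ℚ → ℚ → ℚ
x ⊘ y with y ≟ 0ℚ
... | yes _  = 0ℚ
... | no y≢0 = _÷_ x y {{≢-nonZero y≢0}}

qPoch : ℚ → ℕ → ℚ
qPoch q zero    = 1ℚ
qPoch q (suc k) = qPoch q k ℚ.* (1ℚ ℚ.- q ^ℚ suc k)

-- q-binomial  [a choose b]_q  (used with b ≤ a)
qBinom : ℚ → ℕ → ℕ → ℚ
qBinom q a b = qPoch q a ⊘ (qPoch q b ℚ.* qPoch q (a ∸ b))

data ℕ∞ : Set where
  fin : ℕ → ℕ∞
  ∞   : ℕ∞

InRange : ℕ → ℕ∞ → ℕ → ℕ → Set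
InRange m₁ (fin m₂) k s = (k ∸ m₂ ℕ.≤ s) × (s ℕ.≤ m₁ ⊓ k)
InRange m₁ ∞        k s = s ℕ.≤ m₁ ⊓ k

qHypPmf : ℚ → ℕ → ℕ∞ → ℕ → ℕ → ℚ
qHypPmf q m₁ (fin m₂) k s =
  (q ^ℚ ((m₁ ∸ s) ℕ.* (k ∸ s)) ℚ.* qBinom q m₁ s ℚ.* qBinom q m₂ (k ∸ s))
    ⊘ qBinom q (m₁ ℕ.+ m₂) k
qHypPmf q m₁ ∞ k s =
  (q ^ℚ ((m₁ ∸ s) ℕ.* (k ∸ s)) ℚ.* qPoch q m₁ ℚ.* qPoch q k)
    ⊘ (qPoch q s ℚ.* qPoch q (m₁ ∸ s) ℚ.* qPoch q (k ∸ s))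

InSupport : ℚ → ℕ → ℕ∞ → ℕ → ℕ → Set
InSupport q m₁ m₂ k s = InRange m₁ m₂ k s × (0ℚ ℚ.< qHypPmf q m₁ m₂ k s)

-- A pattern: Pat j k = λ^j_k  (only 1 ≤ k ≤ j ≤ m meaningful; level 0
-- and k > j entries are 0 by construction of qRSK below).
Pat : Set
Pat = ℕ → ℕ → ℕ

zeroPat : Pat
zeroPat _ _ = 0

-- One level of the insertion.
--   old₋ = λ^{j-1}, new₋ = λ̃^{j-1}, old = λ^j, aj = a_j,
--   σ k = a^j_{k+1} (the sample drawn at (j,k), 1 ≤ k < j).
-- a^j_1 = a_j, a^j_k = σ (k-1) for k ≥ 2.
newLevel : (j : ℕ) → (old₋ new₋ old : ℕ → ℕ) → (aj : ℕ) → (σ : ℕ → ℕ) → ℕ → ℕ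
newLevel j old₋ new₋ old aj σ k = go k
  where
    a : ℕ → ℕ
    a (suc zero)    = aj
    a (suc (suc i)) = σ (suc i)
    a zero          = 0
    go : ℕ → ℕ
    go zero = 0
    go (suc i) with suc i ℕ.<ᵇ j | suc i ℕ.≡ᵇ j
    ... | true  | _              =
          (a (suc i) ℕ.+ old (suc i) ℕ.+ (new₋ (suc i) ∸ old₋ (suc i))) ∸ σ (suc i)
    ... | false | true  = old (suc i) ℕ.+ a (suc i)
    ... | false | false = 0

insert : Pat → (a : ℕ → ℕ) → (σ : ℕ → ℕ → ℕ) → Pat
insert λ₀ a σ zero    = λ _ → 0
insert λ₀ a σ (suc j) =
  newLevel (suc j) (λ₀ j) (insert λ₀ a σ j) (λ₀ (suc j)) (a (suc j)) (σ (suc j))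

-- qRSK run: w ℓ j = w_{ℓ,j}, σ ℓ j k = a^j_{k+1} drawn during the ℓ-th insertion.
-- run w σ ℓ = λ(ℓ).
run : (w : ℕ → ℕ → ℕ) → (σ : ℕ → ℕ → ℕ → ℕ) → ℕ → Pat
run w σ zero    = zeroPat
run w σ (suc ℓ) = insert (run w σ ℓ) (w (suc ℓ)) (σ (suc ℓ))

-- Parameters of the qHyp law of a^j_{k+1} in the ℓ-th insertion
-- (with λ = λ(ℓ-1), λ̃ = λ(ℓ); λ^{j-1}_0 = ∞).
m₂Param : Pat → Pat → ℕ → ℕ → ℕ∞
m₂Param old new j (suc zero)    = ∞
m₂Param old new j (suc (suc k)) = fin (old (j ∸ 1) (suc k) ∸ new (j ∸ 1) (suc (suc k)))
m₂Param old new j zero          = fin 0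

-- The realisation σ has positive probability (every sample used for
-- 1 ≤ ℓ ≤ n, 1 ≤ k < j ≤ m has positive conditional probability).
Admissible : ℚ → (n m : ℕ) → (w : ℕ → ℕ → ℕ) → (σ : ℕ → ℕ → ℕ → ℕ) → Set
Admissible q n m w σ =
  ∀ ℓ j k → 1 ℕ.≤ ℓ → ℓ ℕ.≤ n → 1 ℕ.≤ k → k ℕ.< j → j ℕ.≤ m →
    let old = run w σ (ℓ ∸ 1) ; new = run w σ ℓ in
    InSupport q
      (new (j ∸ 1) k ∸ old (j ∸ 1) k)
      (m₂Param old new j k)
      (old j k ∸ old (j ∸ 1) k)
      (σ ℓ j k)

{-# OPTIONS --safe #-}
-- By
-- induction on ℓ and then on the level j: the sample a^j_k drawn at (j, k-1)
-- is supported on 0 … λ^j_{k-1} − λ^{j-1}_{k-1}, and λ^j_{k-1} = 0 before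
-- the insertion, so the sample is 0; every term of the update formula for
-- λ̃^j_k then vanishes.
module Submission where

open import Defs
open import Data.Bool using (true; false; T)
open import Data.Nat using (ℕ; zero; suc; _+_; _∸_; _≤_; _<_; z≤n; s≤s; _<ᵇ_; _≡ᵇ_)
open import Data.Nat.Properties
  using (≤-trans; ≤-pred; ≤-reflexive; <⇒≤; n≤1+n; m≤n⇒m≤1+n; m⊓n≤n; m∸n≤m; 0∸n≡0; n≤0⇒n≡0; <ᵇ⇒<)
open import Data.Product using (_,_; proj₁)
open import Data.Rational using (ℚ; 0ℚ; 1ℚ) renaming (_≤_ to _≤ℚ_; _<_ to _<ℚ_)
open import Data.Unit using (tt)
open import Relation.Binary.PropositionalEquality using (_≡_; refl; sym; subst)

InRange⇒s≤k : ∀ m₁ m₂ k s → InRange m₁ m₂ k s → s ≤ k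
InRange⇒s≤k m₁ (fin m₂) k s (_ , s≤m₁⊓k) = ≤-trans s≤m₁⊓k (m⊓n≤n m₁ k)
InRange⇒s≤k m₁ ∞        k s s≤m₁⊓k       = ≤-trans s≤m₁⊓k (m⊓n≤n m₁ k)

newLevel≡0 : ∀ j old₋ new₋ old aj σ i →
  old (2 + i) ≡ 0 → σ (1 + i) ≡ 0 → (2 + i < j → new₋ (2 + i) ≡ 0) →
  newLevel j old₋ new₋ old aj σ (2 + i) ≡ 0
newLevel≡0 j old₋ new₋ old aj σ i old≡0 σ≡0 new₋≡0
  with 2 + i <ᵇ j in k<ᵇj | 2 + i ≡ᵇ j
... | true | _
  rewrite σ≡0 | old≡0 | new₋≡0 (<ᵇ⇒< (2 + i) j (subst T (sym k<ᵇj) tt))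
        | 0∸n≡0 (old₋ (2 + i)) = 0∸n≡0 (σ (2 + i))
... | false | true  rewrite old≡0 | σ≡0 = refl
... | false | false = refl

module _ {q : ℚ} {n m : ℕ} {w : ℕ → ℕ → ℕ} {σ : ℕ → ℕ → ℕ → ℕ}
         (adm : Admissible q n m w σ) where

  sample≡0 : ∀ {ℓ j k} → ℓ < n → 1 ≤ k → k < j → j ≤ m →
    run w σ ℓ j k ≡ 0 → σ (suc ℓ) j k ≡ 0
  sample≡0 {ℓ} {j} {k} ℓ<n 1≤k k<j j≤m λ≡0 = n≤0⇒n≡0 (≤-trans s≤K K≤0)
    where
    K : ℕ
    K = run w σ ℓ j k ∸ run w σ ℓ (j ∸ 1) k
    s≤K : σ (suc ℓ) j k ≤ K
    s≤K = InRange⇒s≤k _ _ _ _ (proj₁ (adm (suc ℓ) j k (s≤s z≤n) ℓ<n 1≤k k<j j≤m))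
    K≤0 : K ≤ 0
    K≤0 = ≤-trans (m∸n≤m _ (run w σ ℓ (j ∸ 1) k)) (≤-reflexive λ≡0)

  run-ℓ<k⇒≡0 : ∀ ℓ {k j} → ℓ ≤ n → ℓ < k → k ≤ j → j ≤ m → run w σ ℓ j k ≡ 0
  run-ℓ<k⇒≡0 zero _ _ _ _ = refl
  run-ℓ<k⇒≡0 (suc ℓ) {suc (suc i)} ℓ<n (s≤s (s≤s ℓ≤i)) = level _
    where
    level : ∀ j → 2 + i ≤ j → j ≤ m → run w σ (suc ℓ) j (2 + i) ≡ 0
    level (suc j) k≤j j≤m =
      newLevel≡0 (suc j) _ _ _ _ _ i
        (run-ℓ<k⇒≡0 ℓ ℓ≤n (s≤s (m≤n⇒m≤1+n ℓ≤i)) k≤j j≤m)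
        (sample≡0 ℓ<n (s≤s z≤n) k≤j j≤m
          (run-ℓ<k⇒≡0 ℓ ℓ≤n (s≤s ℓ≤i) (<⇒≤ k≤j) j≤m))
        (λ k<j → level j (≤-pred k<j) (≤-trans (n≤1+n j) j≤m))
      where
      ℓ≤n : ℓ ≤ n
      ℓ≤n = ≤-trans (n≤1+n ℓ) ℓ<n

lemma2p5 : (q : ℚ) → 0ℚ ≤ℚ q → q <ℚ 1ℚ →
    (n m : ℕ) (w : ℕ → ℕ → ℕ) (σ : ℕ → ℕ → ℕ → ℕ) →
    Admissible q n m w σ →
    ∀ ℓ k j → ℓ ≤ n → ℓ < k → k ≤ j → j ≤ m → run w σ ℓ j k ≡ 0
lemma2p5 _ _ _ _ _ _ _ adm ℓ _ _ = run-ℓ<k⇒≡0 adm ℓ
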